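{- Let $s$ and $n$ be integers with $2\le s\le n$. Then $$K_1K_2\cdots K_s=\mathrm{Id}-\sum_{j=1}^{s}\mathbf{e}_j\mathbf{e}_j^T-\sum_{j=1}^{s-1}\mathbf{e}_j\mathbf{e}_{j+1}^T+\mathbf{e}_s\mathbf{r}_s$$ and $$K_nK_{n-1}\cdots K_{n-s+1}=\mathrm{Id}-\sum_{j=1}^{s}\mathbf{e}_{n-j+1}\mathbf{e}_{n-j+1}^T-\sum_{j=1}^{s-1}\mathbf{e}_{n-j+1}\mathbf{e}_{n-j}^T+\mathbf{e}_{n-s+1}\mathbf{r}_{n-s+1}.$$
   Context: For a positive integer $n$: - $\mathbf{e}_j$ is the $j$-th standard basis column vector of $\mathbb{Z}^n$; - $\mathbf{r}_j=\big((-1)^j,(-1)^{j+1},\dots,(-1)^{j+n-1}\big)$ is a row vector; - $K_j=\mathrm{Id}-\mathbf{e}_j\mathbf{e}_j^T+\mathbf{e}_j\mathbf{r}_j$ is the $n\times n$ identity matrix with row $j$ replaced by $\mathbf{r}_j$. -}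

module Defs where

open import Data.Nat as ℕ using (ℕ; zero; suc)
open import Data.Integer as ℤ using (ℤ; +_; -[1+_])
open import Data.Fin using (Fin; toℕ)
open import Data.List using (List; []; _∷_; map; upTo; foldr)
open import Data.Bool using (if_then_else_)
import Data.Vec.Functional as VF
open import Relation.Binary.PropositionalEquality using (_≡_)

-- Integer n × n matrices, indexed by Fin n (entry (i,k) is row i, column k;
-- Fin index i corresponds to the 1-based index toℕ i + 1 of the paper).
Mat : ℕ → Set
Mat n = Fin n → Fin n → ℤ

Vec' : ℕ → Set
Vec' n = Fin n → ℤ

ΣFin : ∀ {n} → (Fin n → ℤ) → ℤ
ΣFin f = VF.foldr ℤ._+_ (+ 0) f

Id : ∀ {n} → Mat n
Id i k = if toℕ i ℕ.≡ᵇ toℕ k then + 1 else + 0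

_⊕_ : ∀ {n} → Mat n → Mat n → Mat n
(A ⊕ B) i k = A i k ℤ.+ B i k

_⊖_ : ∀ {n} → Mat n → Mat n → Mat n
(A ⊖ B) i k = A i k ℤ.- B i k

infixl 6 _⊕_ _⊖_
infixl 7 _⊗_

_⊗_ : ∀ {n} → Mat n → Mat n → Mat n
(A ⊗ B) i k = ΣFin (λ l → A i l ℤ.* B l k)

outer : ∀ {n} → Vec' n → Vec' n → Mat n
outer u v i k = u i ℤ.* v k

-- e j : j-th standard basis column vector, j 1-based (1 ≤ j ≤ n)
e : ∀ {n} → ℕ → Vec' n
e j i = if suc (toℕ i) ℕ.≡ᵇ j then + 1 else + 0

-- r j = ((-1)^j, (-1)^(j+1), ..., (-1)^(j+n-1)), j 1-based
r : ∀ {n} → ℕ → Vec' n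
r j k = (ℤ.- (+ 1)) ℤ.^ (j ℕ.+ toℕ k)

K : ∀ {n} → ℕ → Mat n
K j = Id ⊖ outer (e j) (e j) ⊕ outer (e j) (r j)

prodM : ∀ {n} → List (Mat n) → Mat n
prodM = foldr _⊗_ Id

sumM : ∀ {n} → List (Mat n) → Mat n
sumM = foldr _⊕_ (λ _ _ → + 0)

oneTo : ℕ → List ℕ
oneTo s = map suc (upTo s)

_≐_ : ∀ {n} → Mat n → Mat n → Set
A ≐ B = ∀ i k → A i k ≡ B i k

{-# OPTIONS --safe #-}
-- Since K_c = Id + e_c (r_c − e_c)ᵀ, right multiplication by K_c adds (X e_c)(r_c − e_c)ᵀ to X.
-- Both products are K_{c 1} ⋯ K_{c s} for a sequence of distinct positions in which consecutive
-- ones are adjacent (c j = j, resp. c j = n + 1 − j), and for every such sequence the product is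
--   chain c s = Id − Σ_{j ≤ s} e_{c j} e_{c j}ᵀ − Σ_{j < s} e_{c j} e_{c (j+1)}ᵀ + e_{c s} r_{c s}.
-- Induction on s: in the column of chain c s at c (s+1) both sums vanish by distinctness and the
-- entry of r_{c s} is 1 by adjacency, so that column is e_{c (s+1)} + e_{c s}; as r_{c (s+1)} = −r_{c s},
-- the rank-one update turns chain c s into chain c (s+1).
module Submission where

open import Defs
open import Data.Nat using (ℕ; suc; _+_; _∸_; _≤_)
open import Data.List using (map)
open import Data.Product using (_×_)

open import Data.Nat using (zero; _*_; _<_; _≟_; z≤n; s≤s)
import Data.Nat.Properties as ℕₚ
open import Data.Integer using (ℤ; +_; -_)
  renaming (_+_ to _+ᶻ_; _-_ to _-ᶻ_; _*_ to _*ᶻ_; _^_ to _^ᶻ_)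
import Data.Integer.Properties as ℤₚ
open import Data.Integer.Solver using (module +-*-Solver)
open import Data.Fin using (Fin; toℕ; fromℕ<)
import Data.Fin as Fin
open import Data.Fin.Properties using (toℕ-fromℕ<)
open import Data.List using (List; []; _∷_; _++_; [_]; upTo)
import Data.List.Properties as Listₚ
open import Data.Product using (_,_; ∃-syntax)
open import Data.Bool using (if_then_else_)
open import Function using (_∘_)
open import Data.Sum using (_⊎_; inj₁; inj₂)
open import Relation.Nullary.Decidable using (dec-false)
open import Relation.Binary.PropositionalEquality
  using (_≡_; _≢_; refl; sym; trans; cong; cong₂; module ≡-Reasoning)
import Algebra.Properties.Semiring.Sum as SemiringSum

open +-*-Solver using (solve; _:+_; _:-_; _:*_; :-_; _:=_; con)
open ≡-Reasoning

private
  module Σ = SemiringSum ℤₚ.+-*-semiring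

ΣFin-zero : ∀ {n} (f : Fin n → ℤ) → (∀ l → f l ≡ + 0) → ΣFin f ≡ + 0
ΣFin-zero {n} f f≗0 = trans (Σ.sum-cong-≗ f≗0) (Σ.sum-replicate-zero n)

ΣFin-*-Id : ∀ {n} (f : Fin n → ℤ) k → ΣFin (λ l → f l *ᶻ Id l k) ≡ f k
ΣFin-*-Id f Fin.zero = trans
  (cong₂ _+ᶻ_ (ℤₚ.*-identityʳ (f Fin.zero)) (ΣFin-zero _ (λ l → ℤₚ.*-zeroʳ (f (Fin.suc l)))))
  (ℤₚ.+-identityʳ (f Fin.zero))
ΣFin-*-Id f (Fin.suc k) = trans
  (cong₂ _+ᶻ_ (ℤₚ.*-zeroʳ (f Fin.zero)) (ΣFin-*-Id (λ l → f (Fin.suc l)) k))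
  (ℤₚ.+-identityˡ (f (Fin.suc k)))

Id-*-ΣFin : ∀ {n} (f : Fin n → ℤ) i → ΣFin (λ l → Id i l *ᶻ f l) ≡ f i
Id-*-ΣFin f Fin.zero = trans
  (cong₂ _+ᶻ_ (ℤₚ.*-identityˡ (f Fin.zero)) (ΣFin-zero _ (λ l → ℤₚ.*-zeroˡ (f (Fin.suc l)))))
  (ℤₚ.+-identityʳ (f Fin.zero))
Id-*-ΣFin f (Fin.suc i) = trans
  (cong₂ _+ᶻ_ (ℤₚ.*-zeroˡ (f Fin.zero)) (Id-*-ΣFin (λ l → f (Fin.suc l)) i))
  (ℤₚ.+-identityˡ (f (Fin.suc i)))

⊗-identityʳ : ∀ {n} (A : Mat n) → (A ⊗ Id) ≐ A
⊗-identityʳ A i = ΣFin-*-Id (A i)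

⊗-identityˡ : ∀ {n} (A : Mat n) → (Id ⊗ A) ≐ A
⊗-identityˡ A i k = Id-*-ΣFin (λ l → A l k) i

⊗-congˡ : ∀ {n} {A A′ : Mat n} (B : Mat n) → A ≐ A′ → (A ⊗ B) ≐ (A′ ⊗ B)
⊗-congˡ B A≐A′ i k = Σ.sum-cong-≗ (λ l → cong (_*ᶻ B l k) (A≐A′ i l))

⊗-congʳ : ∀ {n} (A : Mat n) {B B′ : Mat n} → B ≐ B′ → (A ⊗ B) ≐ (A ⊗ B′)
⊗-congʳ A B≐B′ i k = Σ.sum-cong-≗ (λ l → cong (A i l *ᶻ_) (B≐B′ l k))

⊗-assoc : ∀ {n} (A B C : Mat n) → ((A ⊗ B) ⊗ C) ≐ (A ⊗ (B ⊗ C))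
⊗-assoc A B C i k = begin
  ΣFin (λ m → ΣFin (λ l → A i l *ᶻ B l m) *ᶻ C m k)
    ≡⟨ Σ.sum-cong-≗ (λ m → Σ.*-distribʳ-sum (C m k) (λ l → A i l *ᶻ B l m)) ⟩
  ΣFin (λ m → ΣFin (λ l → A i l *ᶻ B l m *ᶻ C m k))
    ≡⟨ sym (Σ.∑-comm (λ l m → A i l *ᶻ B l m *ᶻ C m k)) ⟩
  ΣFin (λ l → ΣFin (λ m → A i l *ᶻ B l m *ᶻ C m k))
    ≡⟨ Σ.sum-cong-≗ (λ l → trans (Σ.sum-cong-≗ (λ m → ℤₚ.*-assoc (A i l) (B l m) (C m k)))
                                  (sym (Σ.*-distribˡ-sum (A i l) (λ m → B l m *ᶻ C m k)))) ⟩
  ΣFin (λ l → A i l *ᶻ ΣFin (λ m → B l m *ᶻ C m k)) ∎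

prodM-∷ʳ : ∀ {n} (As : List (Mat n)) B → prodM (As ++ [ B ]) ≐ (prodM As ⊗ B)
prodM-∷ʳ [] B i k = trans (⊗-identityʳ B i k) (sym (⊗-identityˡ B i k))
prodM-∷ʳ (A ∷ As) B i k =
  trans (⊗-congʳ A (prodM-∷ʳ As B) i k) (sym (⊗-assoc A (prodM As) B i k))

sumM-∷ʳ : ∀ {n} (As : List (Mat n)) B i k → sumM (As ++ [ B ]) i k ≡ sumM As i k +ᶻ B i k
sumM-∷ʳ [] B i k = trans (ℤₚ.+-identityʳ (B i k)) (sym (ℤₚ.+-identityˡ (B i k)))
sumM-∷ʳ (A ∷ As) B i k =
  trans (cong (A i k +ᶻ_) (sumM-∷ʳ As B i k)) (sym (ℤₚ.+-assoc (A i k) _ (B i k)))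

map-oneTo-suc : ∀ {A : Set} (f : ℕ → A) s → map f (oneTo (suc s)) ≡ map f (oneTo s) ++ [ f (suc s) ]
map-oneTo-suc f s = begin
  map f (map suc (upTo (suc s)))        ≡⟨ cong (λ xs → map f (map suc xs)) (sym (Listₚ.upTo-∷ʳ s)) ⟩
  map f (map suc (upTo s ++ [ s ]))     ≡⟨ cong (map f) (Listₚ.map-++ suc (upTo s) [ s ]) ⟩
  map f (oneTo s ++ [ suc s ])          ≡⟨ Listₚ.map-++ f (oneTo s) [ suc s ] ⟩
  map f (oneTo s) ++ [ f (suc s) ]      ∎

sumM-oneTo-suc : ∀ {n} (G : ℕ → Mat n) s i k →
  sumM (map G (oneTo (suc s))) i k ≡ sumM (map G (oneTo s)) i k +ᶻ G (suc s) i k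
sumM-oneTo-suc G s i k =
  trans (cong (λ As → sumM As i k) (map-oneTo-suc G s)) (sumM-∷ʳ (map G (oneTo s)) (G (suc s)) i k)

sumM-oneTo-zero : ∀ {n} (G : ℕ → Mat n) s i k →
  (∀ {j} → 1 ≤ j → j ≤ s → G j i k ≡ + 0) → sumM (map G (oneTo s)) i k ≡ + 0
sumM-oneTo-zero G zero i k _ = refl
sumM-oneTo-zero G (suc s) i k vanish = begin
  sumM (map G (oneTo (suc s))) i k          ≡⟨ sumM-oneTo-suc G s i k ⟩
  sumM (map G (oneTo s)) i k +ᶻ G (suc s) i k
    ≡⟨ cong₂ _+ᶻ_ (sumM-oneTo-zero G s i k (λ 1≤j j≤s → vanish 1≤j (ℕₚ.m≤n⇒m≤1+n j≤s)))
                  (vanish (s≤s z≤n) ℕₚ.≤-refl) ⟩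
  + 0                                       ∎

K-entry : ∀ {n} c (i k : Fin n) → K c i k ≡ Id i k +ᶻ e c i *ᶻ (r c k -ᶻ e c k)
K-entry c i k = solve 4 (λ δ x y z → (δ :- x :* y) :+ x :* z := δ :+ x :* (z :- y)) refl
  (Id i k) (e c i) (e c k) (r c k)

⊗-K : ∀ {n} (A : Mat n) {c} κ → c ≡ suc (toℕ κ) → ∀ i k →
  (A ⊗ K c) i k ≡ A i k +ᶻ A i κ *ᶻ (r c k -ᶻ e c k)
⊗-K A {c} κ refl i k = begin
  ΣFin (λ l → A i l *ᶻ K c l k)
    ≡⟨ Σ.sum-cong-≗ (λ l → trans (cong (A i l *ᶻ_) (K-entry c l k)) (distrib (A i l) (Id l k) (e c l))) ⟩
  ΣFin (λ l → A i l *ᶻ Id l k +ᶻ A i l *ᶻ Id l κ *ᶻ v)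
    ≡⟨ Σ.∑-distrib-+ (λ l → A i l *ᶻ Id l k) (λ l → A i l *ᶻ Id l κ *ᶻ v) ⟩
  ΣFin (λ l → A i l *ᶻ Id l k) +ᶻ ΣFin (λ l → A i l *ᶻ Id l κ *ᶻ v)
    ≡⟨ cong₂ _+ᶻ_ (ΣFin-*-Id (A i) k)
                  (trans (sym (Σ.*-distribʳ-sum v (λ l → A i l *ᶻ Id l κ))) (cong (_*ᶻ v) (ΣFin-*-Id (A i) κ))) ⟩
  A i k +ᶻ A i κ *ᶻ v ∎
  where
  v = r c k -ᶻ e c k
  distrib : ∀ a δ x → a *ᶻ (δ +ᶻ x *ᶻ v) ≡ a *ᶻ δ +ᶻ a *ᶻ x *ᶻ v
  distrib a δ x = solve 4 (λ a δ x v → a :* (δ :+ x :* v) := a :* δ :+ a :* x :* v) refl a δ x v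

e-apart : ∀ {n} c (k : Fin n) → c ≢ suc (toℕ k) → e c k ≡ + 0
e-apart c k c≢k = cong (λ b → if b then + 1 else + 0) (dec-false (suc (toℕ k) ≟ c) (λ k≡c → c≢k (sym k≡c)))

Adjacent : ℕ → ℕ → Set
Adjacent a b = b ≡ suc a ⊎ a ≡ suc b

r-suc : ∀ {n} a (k : Fin n) → r (suc a) k ≡ - r a k
r-suc a k = ℤₚ.-1*i≡-i (r a k)

r-adjacent : ∀ {n} {a b} → Adjacent a b → (k : Fin n) → r a k ≡ - r b k
r-adjacent {a = a} (inj₁ refl) k = sym (trans (cong -_ (r-suc a k)) (ℤₚ.neg-involutive (r a k)))
r-adjacent {b = b} (inj₂ refl) k = r-suc b k

r-diagonal : ∀ {n} (k : Fin n) → r (toℕ k) k ≡ + 1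
r-diagonal k = begin
  (- + 1) ^ᶻ (m + m)   ≡⟨ cong (λ x → (- + 1) ^ᶻ (m + x)) (sym (ℕₚ.+-identityʳ m)) ⟩
  (- + 1) ^ᶻ (2 * m)   ≡⟨ sym (ℤₚ.^-*-assoc (- + 1) 2 m) ⟩
  (+ 1) ^ᶻ m           ≡⟨ ℤₚ.^-zeroˡ m ⟩
  + 1                  ∎
  where
  m = toℕ k

record SimplePath (n s : ℕ) (c : ℕ → ℕ) : Set where
  field
    inRange  : ∀ {j} → 1 ≤ j → j ≤ s → 1 ≤ c j × c j ≤ n
    distinct : ∀ {i j} → 1 ≤ i → i < j → j ≤ s → c i ≢ c j
    adjacent : ∀ {j} → 1 ≤ j → j < s → Adjacent (c j) (c (suc j))

SimplePath-init : ∀ {n s c} → SimplePath n (suc s) c → SimplePath n s c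
SimplePath-init path = record
  { inRange  = λ 1≤j j≤s → inRange 1≤j (ℕₚ.m≤n⇒m≤1+n j≤s)
  ; distinct = λ 1≤i i<j j≤s → distinct 1≤i i<j (ℕₚ.m≤n⇒m≤1+n j≤s)
  ; adjacent = λ 1≤j j<s → adjacent 1≤j (ℕₚ.m≤n⇒m≤1+n j<s)
  }
  where open SimplePath path

position : ∀ {m n} → 1 ≤ m × m ≤ n → ∃[ κ ] m ≡ suc (toℕ {n} κ)
position {suc m} (_ , m<n) = fromℕ< m<n , cong suc (sym (toℕ-fromℕ< m<n))

chain : ∀ {n} → (ℕ → ℕ) → ℕ → Mat n
chain c s = Id ⊖ sumM (map (λ j → outer (e (c j)) (e (c j))) (oneTo s))
               ⊖ sumM (map (λ j → outer (e (c j)) (e (c (suc j)))) (oneTo (s ∸ 1)))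
               ⊕ outer (e (c s)) (r (c s))

chain-column : ∀ {n c} t → SimplePath n (suc (suc t)) c →
  ∀ κ → c (suc (suc t)) ≡ suc (toℕ κ) → ∀ i →
  chain c (suc t) i κ ≡ e (c (suc (suc t))) i +ᶻ e (c (suc t)) i
chain-column {n} {c} t path κ c′≡κ i = begin
  ((Id i κ -ᶻ S₁) -ᶻ S₂) +ᶻ e (c s) i *ᶻ r (c s) κ
    ≡⟨ cong₂ (λ x y → ((Id i κ -ᶻ x) -ᶻ y) +ᶻ e (c s) i *ᶻ r (c s) κ) S₁≡0 S₂≡0 ⟩
  ((Id i κ -ᶻ + 0) -ᶻ + 0) +ᶻ e (c s) i *ᶻ r (c s) κ
    ≡⟨ cong₂ (λ x y → ((x -ᶻ + 0) -ᶻ + 0) +ᶻ e (c s) i *ᶻ y) (cong (λ m → e m i) (sym c′≡κ)) r≡1 ⟩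
  ((e c′ i -ᶻ + 0) -ᶻ + 0) +ᶻ e (c s) i *ᶻ + 1
    ≡⟨ solve 2 (λ x y → ((x :- con (+ 0)) :- con (+ 0)) :+ y :* con (+ 1) := x :+ y) refl (e c′ i) (e (c s) i) ⟩
  e c′ i +ᶻ e (c s) i ∎
  where
  open SimplePath path
  s = suc t
  c′ = c (suc s)
  G₁ G₂ : ℕ → Mat n
  G₁ j = outer (e (c j)) (e (c j))
  G₂ j = outer (e (c j)) (e (c (suc j)))
  S₁ = sumM (map G₁ (oneTo s)) i κ
  S₂ = sumM (map G₂ (oneTo t)) i κ
  apart : ∀ {j} → 1 ≤ j → j ≤ s → e (c j) κ ≡ + 0
  apart {j} 1≤j j≤s = e-apart (c j) κ (λ cj≡κ → distinct 1≤j (s≤s j≤s) ℕₚ.≤-refl (trans cj≡κ (sym c′≡κ)))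
  S₁≡0 : S₁ ≡ + 0
  S₁≡0 = sumM-oneTo-zero G₁ s i κ
    (λ {j} 1≤j j≤s → trans (cong (e (c j) i *ᶻ_) (apart 1≤j j≤s)) (ℤₚ.*-zeroʳ (e (c j) i)))
  S₂≡0 : S₂ ≡ + 0
  S₂≡0 = sumM-oneTo-zero G₂ t i κ
    (λ {j} _ j≤t → trans (cong (e (c j) i *ᶻ_) (apart (s≤s z≤n) (s≤s j≤t))) (ℤₚ.*-zeroʳ (e (c j) i)))
  r≡1 : r (c s) κ ≡ + 1
  r≡1 = begin
    r (c s) κ                  ≡⟨ r-adjacent (adjacent (s≤s z≤n) ℕₚ.≤-refl) κ ⟩
    - r c′ κ                   ≡⟨ cong (λ m → - r m κ) c′≡κ ⟩
    - r (suc (toℕ κ)) κ        ≡⟨ sym (r-adjacent {a = toℕ κ} (inj₁ refl) κ) ⟩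
    r (toℕ κ) κ                ≡⟨ r-diagonal κ ⟩
    + 1                        ∎

chain-suc : ∀ {n c} t → Adjacent (c (suc t)) (c (suc (suc t))) → ∀ (i k : Fin n) →
  chain c (suc (suc t)) i k
    ≡ chain c (suc t) i k
      +ᶻ (e (c (suc (suc t))) i +ᶻ e (c (suc t)) i) *ᶻ (r (c (suc (suc t))) k -ᶻ e (c (suc (suc t))) k)
chain-suc {n} {c} t adj i k = begin
  ((Id i k -ᶻ sumM (map G₁ (oneTo (suc s))) i k) -ᶻ sumM (map G₂ (oneTo s)) i k) +ᶻ a *ᶻ y
    ≡⟨ cong₂ (λ u v → ((Id i k -ᶻ u) -ᶻ v) +ᶻ a *ᶻ y) (sumM-oneTo-suc G₁ s i k) (sumM-oneTo-suc G₂ t i k) ⟩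
  ((Id i k -ᶻ (S₁ +ᶻ a *ᶻ x)) -ᶻ (S₂ +ᶻ b *ᶻ x)) +ᶻ a *ᶻ y
    ≡⟨ solve 7 (λ δ S₁ S₂ a b x y →
         ((δ :- (S₁ :+ a :* x)) :- (S₂ :+ b :* x)) :+ a :* y
         := (((δ :- S₁) :- S₂) :+ b :* (:- y)) :+ (a :+ b) :* (y :- x)) refl (Id i k) S₁ S₂ a b x y ⟩
  (((Id i k -ᶻ S₁) -ᶻ S₂) +ᶻ b *ᶻ - y) +ᶻ (a +ᶻ b) *ᶻ (y -ᶻ x)
    ≡⟨ cong (λ z → (((Id i k -ᶻ S₁) -ᶻ S₂) +ᶻ b *ᶻ z) +ᶻ (a +ᶻ b) *ᶻ (y -ᶻ x)) (sym (r-adjacent adj k)) ⟩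
  (((Id i k -ᶻ S₁) -ᶻ S₂) +ᶻ b *ᶻ r (c s) k) +ᶻ (a +ᶻ b) *ᶻ (y -ᶻ x) ∎
  where
  s = suc t
  G₁ G₂ : ℕ → Mat n
  G₁ j = outer (e (c j)) (e (c j))
  G₂ j = outer (e (c j)) (e (c (suc j)))
  S₁ = sumM (map G₁ (oneTo s)) i k
  S₂ = sumM (map G₂ (oneTo t)) i k
  a = e (c (suc s)) i
  b = e (c s) i
  x = e (c (suc s)) k
  y = r (c (suc s)) k

chain-product : ∀ {n c} t → SimplePath n (suc t) c →
  prodM {n} (map (λ j → K (c j)) (oneTo (suc t))) ≐ chain c (suc t)
chain-product {c = c} zero _ i k = trans (⊗-identityʳ (K (c 1)) i k)
  (solve 3 (λ δ x y → (δ :- x) :+ y := ((δ :- (x :+ con (+ 0))) :- con (+ 0)) :+ y) refl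
     (Id i k) (e (c 1) i *ᶻ e (c 1) k) (e (c 1) i *ᶻ r (c 1) k))
chain-product {n} {c} (suc t) path i k
  with κ , c′≡κ ← position {n = n} (SimplePath.inRange path (s≤s z≤n) ℕₚ.≤-refl) = begin
  prodM (map K′ (oneTo (suc s))) i k
    ≡⟨ cong (λ As → prodM As i k) (map-oneTo-suc K′ s) ⟩
  prodM (map K′ (oneTo s) ++ [ K′ (suc s) ]) i k
    ≡⟨ prodM-∷ʳ (map K′ (oneTo s)) (K′ (suc s)) i k ⟩
  (prodM (map K′ (oneTo s)) ⊗ K′ (suc s)) i k
    ≡⟨ ⊗-congˡ (K′ (suc s)) (chain-product t (SimplePath-init path)) i k ⟩
  (chain c s ⊗ K′ (suc s)) i k
    ≡⟨ ⊗-K (chain c s) κ c′≡κ i k ⟩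
  chain c s i k +ᶻ chain c s i κ *ᶻ (r (c (suc s)) k -ᶻ e (c (suc s)) k)
    ≡⟨ cong (λ z → chain c s i k +ᶻ z *ᶻ (r (c (suc s)) k -ᶻ e (c (suc s)) k))
            (chain-column {c = c} t path κ c′≡κ i) ⟩
  chain c s i k +ᶻ (e (c (suc s)) i +ᶻ e (c s) i) *ᶻ (r (c (suc s)) k -ᶻ e (c (suc s)) k)
    ≡⟨ sym (chain-suc {c = c} t (adjacent (s≤s z≤n) ℕₚ.≤-refl) i k) ⟩
  chain c (suc s) i k ∎
  where
  open SimplePath path
  s = suc t
  K′ : ℕ → Mat n
  K′ j = K (c j)

ascending : ∀ {n s} → s ≤ n → SimplePath n s (λ j → j)
ascending s≤n = record
  { inRange  = λ 1≤j j≤s → 1≤j , ℕₚ.≤-trans j≤s s≤n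
  ; distinct = λ _ i<j _ → ℕₚ.<⇒≢ i<j
  ; adjacent = λ _ _ → inj₁ refl
  }

m+1∸[1+n]≡m∸n : ∀ m n → m + 1 ∸ suc n ≡ m ∸ n
m+1∸[1+n]≡m∸n m n = cong (_∸ suc n) (ℕₚ.+-comm m 1)

m+1∸n≡1+m∸n : ∀ {m n} → n ≤ m → m + 1 ∸ n ≡ suc (m ∸ n)
m+1∸n≡1+m∸n {m} {n} n≤m = trans (ℕₚ.+-∸-comm 1 n≤m) (ℕₚ.+-comm (m ∸ n) 1)

descending : ∀ {n s} → s ≤ n → SimplePath n s (λ j → n + 1 ∸ j)
descending {n} {s} s≤n = record
  { inRange  = λ 1≤j j≤s → bounds 1≤j (ℕₚ.≤-trans j≤s s≤n)
  ; distinct = λ _ i<j j≤s →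
      ℕₚ.<⇒≢ i<j ∘ ℕₚ.∸-cancelˡ-≡ (≤n+1 (ℕₚ.<⇒≤ (ℕₚ.<-≤-trans i<j j≤s))) (≤n+1 j≤s)
  ; adjacent = λ {j} _ j<s →
      inj₂ (trans (m+1∸n≡1+m∸n (ℕₚ.≤-trans (ℕₚ.<⇒≤ j<s) s≤n)) (cong suc (sym (m+1∸[1+n]≡m∸n n j))))
  }
  where
  bounds : ∀ {j} → 1 ≤ j → j ≤ n → 1 ≤ n + 1 ∸ j × n + 1 ∸ j ≤ n
  bounds 1≤j j≤n rewrite m+1∸n≡1+m∸n j≤n = s≤s z≤n , ℕₚ.∸-monoʳ-< 1≤j j≤n
  ≤n+1 : ∀ {j} → j ≤ s → j ≤ n + 1
  ≤n+1 j≤s = ℕₚ.≤-trans (ℕₚ.≤-trans j≤s s≤n) (ℕₚ.m≤m+n n 1)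

lemma2p5 : (s n : ℕ) → 2 ≤ s → s ≤ n →
    (prodM {n} (map K (oneTo s))
      ≐ (Id ⊖ sumM (map (λ j → outer (e j) (e j)) (oneTo s))
            ⊖ sumM (map (λ j → outer (e j) (e (suc j))) (oneTo (s ∸ 1)))
            ⊕ outer (e s) (r s)))
    ×
    (prodM {n} (map (λ j → K (n + 1 ∸ j)) (oneTo s))
      ≐ (Id ⊖ sumM (map (λ j → outer (e (n + 1 ∸ j)) (e (n + 1 ∸ j))) (oneTo s))
            ⊖ sumM (map (λ j → outer (e (n + 1 ∸ j)) (e (n ∸ j))) (oneTo (s ∸ 1)))
            ⊕ outer (e (n + 1 ∸ s)) (r (n + 1 ∸ s))))
lemma2p5 (suc t) n _ s≤n =
  chain-product t (ascending s≤n) ,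
  λ i k → trans (chain-product t (descending s≤n) i k) (cong (λ S → chain-with S i k) next≡)
  where
  c : ℕ → ℕ
  c j = n + 1 ∸ j
  chain-with : Mat n → Mat n
  chain-with S = Id ⊖ sumM (map (λ j → outer (e (c j)) (e (c j))) (oneTo (suc t)))
                    ⊖ S
                    ⊕ outer (e (c (suc t))) (r (c (suc t)))
  next≡ : sumM (map (λ j → outer (e (c j)) (e (c (suc j)))) (oneTo t))
        ≡ sumM (map (λ j → outer (e (c j)) (e (n ∸ j))) (oneTo t))
  next≡ = cong sumM (Listₚ.map-cong (λ j → cong (λ m → outer (e (c j)) (e m)) (m+1∸[1+n]≡m∸n n j)) (oneTo t))
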